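{- Let $m<n$ be positive integers. If the Domineering board with $m$ rows and $n$ columns is either a second-player win or a win for Vera, then the board with $n-m$ rows and $n$ columns is not a win for Vera.
   Context: Domineering is a two-player game on a board of cells of the square lattice. Vera places vertical dominoes (covering two vertically adjacent empty cells), Hepzibah places horizontal dominoes (covering two horizontally adjacent empty cells); they alternate, and a player unable to move on her turn loses. A position is a win for Vera if she wins regardless of who moves first, and a second-player win if whoever moves second wins. -}

module Defs where

open import Data.Nat using (ℕ; suc)
open import Data.Fin using (Fin; toℕ; _≟_)
open import Data.Bool using (Bool; true; false; if_then_else_)
open import Data.Product using (_×_)
open import Relation.Nullary.Decidable using (⌊_⌋)
open import Relation.Binary.PropositionalEquality using (_≡_)
open import Data.Bool using (_∧_)

-- A Domineering position on an m-row, n-column rectangle: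
-- b i j ≡ true  iff the cell in row i, column j is empty.
Board : ℕ → ℕ → Set
Board m n = Fin m → Fin n → Bool

emptyBoard : (m n : ℕ) → Board m n
emptyBoard m n = λ _ _ → true

fill : ∀ {m n} → Board m n → Fin m → Fin n → Board m n
fill b i j = λ x y → if ⌊ x ≟ i ⌋ ∧ ⌊ y ≟ j ⌋ then false else b x y

-- Game outcomes, defined inductively (the game is finite).
--   HepLosesFirst b : Hepzibah to move on b, and Hepzibah loses
--                     (every horizontal move leads to a VeraWinsFirst position;
--                      in particular, when Hepzibah has no move).
-- Vera places vertical dominoes (cells (i,j),(i+1,j)),
-- Hepzibah horizontal ones (cells (i,j),(i,j+1)).
data VeraWinsFirst {m n : ℕ} : Board m n → Set
data HepLosesFirst {m n : ℕ} : Board m n → Set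
data HepWinsFirst {m n : ℕ} : Board m n → Set
data VeraLosesFirst {m n : ℕ} : Board m n → Set

data VeraWinsFirst {m} {n} where
  vmove : ∀ {b} (i i' : Fin m) (j : Fin n) → toℕ i' ≡ suc (toℕ i) →
          b i j ≡ true → b i' j ≡ true →
          HepLosesFirst (fill (fill b i j) i' j) → VeraWinsFirst b

data HepLosesFirst {m} {n} where
  hlose : ∀ {b} →
          ((i : Fin m) (j j' : Fin n) → toℕ j' ≡ suc (toℕ j) →
           b i j ≡ true → b i j' ≡ true →
           VeraWinsFirst (fill (fill b i j) i j')) → HepLosesFirst b

data HepWinsFirst {m} {n} where
  hmove : ∀ {b} (i : Fin m) (j j' : Fin n) → toℕ j' ≡ suc (toℕ j) →
          b i j ≡ true → b i j' ≡ true →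
          VeraLosesFirst (fill (fill b i j) i j') → HepWinsFirst b

data VeraLosesFirst {m} {n} where
  vlose : ∀ {b} →
          ((i i' : Fin m) (j : Fin n) → toℕ i' ≡ suc (toℕ i) →
           b i j ≡ true → b i' j ≡ true →
           HepWinsFirst (fill (fill b i j) i' j)) → VeraLosesFirst b

VeraWin : ∀ {m n} → Board m n → Set
VeraWin b = VeraWinsFirst b × HepLosesFirst b

SecondPlayerWin : ∀ {m n} → Board m n → Set
SecondPlayerWin b = VeraLosesFirst b × HepLosesFirst b

{-# OPTIONS --safe #-}
-- Stack the m × n board on top of the (n ∸ m) × n board. Hepzibah's dominoes
-- always lie inside one of the two parts, and Vera never needs the vertical
-- dominoes straddling the seam, so she plays the sum of the two games: if
-- Hepzibah moving first loses the top part and Vera wins the bottom part, then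
-- Vera wins the n × n square. But transposition swaps the players, and the
-- square is its own transpose, so it cannot be a win for Vera.
module Submission where

open import Defs
open import Data.Nat using (ℕ; _<_; _∸_; _+_; zero; suc)
open import Data.Nat.Properties using (m+[n∸m]≡n; <⇒≤; +-suc)
open import Data.Fin using (Fin; toℕ; _≟_; _↑ˡ_; _↑ʳ_; zero; suc; splitAt)
open import Data.Fin.Properties using (toℕ-↑ˡ; toℕ-↑ʳ; ↑ˡ-injective; ↑ʳ-injective; splitAt-↑ˡ; splitAt-↑ʳ)
open import Data.Bool using (true; false; if_then_else_)
open import Data.Product using (_,_; proj₂)
open import Data.Sum using (_⊎_; [_,_])
open import Data.Empty using (⊥-elim)
open import Function.Definitions using (Injective)
open import Relation.Nullary using (¬_; yes; no)
open import Relation.Binary.PropositionalEquality using (_≡_; _≢_; refl; sym; trans; cong; subst)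

Adjacent : ∀ {m} → Fin m → Fin m → Set
Adjacent i i' = toℕ i' ≡ suc (toℕ i)

mutual
  veraWinsFirst⇒¬veraLosesFirst : ∀ {m n} {b : Board m n} → VeraWinsFirst b → ¬ VeraLosesFirst b
  veraWinsFirst⇒¬veraLosesFirst (vmove i i' j adj e e' win) (vlose replies) =
    hepLosesFirst⇒¬hepWinsFirst win (replies i i' j adj e e')

  hepLosesFirst⇒¬hepWinsFirst : ∀ {m n} {b : Board m n} → HepLosesFirst b → ¬ HepWinsFirst b
  hepLosesFirst⇒¬hepWinsFirst (hlose replies) (hmove i j j' adj e e' win) =
    veraWinsFirst⇒¬veraLosesFirst (replies i j j' adj e e') win

Transposed : ∀ {m n} → Board n m → Board m n → Set
Transposed c b = ∀ x y → c x y ≡ b y x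

fill-transposed : ∀ {m n} {c : Board n m} {b : Board m n} (i : Fin m) (j : Fin n) →
                  Transposed c b → Transposed (fill c j i) (fill b i j)
fill-transposed i j t x y with x ≟ j | y ≟ i
... | yes _ | yes _ = refl
... | yes _ | no _  = t x y
... | no _  | yes _ = t x y
... | no _  | no _  = t x y

mutual
  veraWinsFirst-transpose : ∀ {m n} {c : Board n m} {b : Board m n} →
                            Transposed c b → VeraWinsFirst b → HepWinsFirst c
  veraWinsFirst-transpose t (vmove i i' j adj e e' win) =
    hmove j i i' adj (trans (t j i) e) (trans (t j i') e')
      (hepLosesFirst-transpose (fill-transposed i' j (fill-transposed i j t)) win)

  hepLosesFirst-transpose : ∀ {m n} {c : Board n m} {b : Board m n} →
                            Transposed c b → HepLosesFirst b → VeraLosesFirst c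
  hepLosesFirst-transpose t (hlose replies) = vlose λ i i' j adj e e' →
    veraWinsFirst-transpose (fill-transposed j i' (fill-transposed j i t))
      (replies j i i' adj (trans (sym (t i j)) e) (trans (sym (t i' j)) e'))

symmetric⇒¬veraWin : ∀ {n} {b : Board n n} → Transposed b b → ¬ VeraWin b
symmetric⇒¬veraWin t (veraFirst , hepFirst) =
  veraWinsFirst⇒¬veraLosesFirst veraFirst (hepLosesFirst-transpose t hepFirst)

Restricts : ∀ {a m n} → (Fin a → Fin m) → Board m n → Board a n → Set
Restricts f B G = ∀ x y → B (f x) y ≡ G x y

fill-restricts : ∀ {a m n} {f : Fin a → Fin m} {B : Board m n} {G : Board a n} →
                 Injective _≡_ _≡_ f → (i : Fin a) (j : Fin n) →
                 Restricts f B G → Restricts f (fill B (f i) j) (fill G i j)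
fill-restricts {f = f} f-inj i j r x y with f x ≟ f i | x ≟ i
... | yes _     | yes _    = cong (λ c → if _ then false else c) (r x y)
... | no _      | no _     = r x y
... | yes fx≡fi | no x≢i   = ⊥-elim (x≢i (f-inj fx≡fi))
... | no fx≢fi  | yes refl = ⊥-elim (fx≢fi refl)

fill-restricts-outside : ∀ {a m n} {f : Fin a → Fin m} {B : Board m n} {G : Board a n} →
                         (r : Fin m) (j : Fin n) → (∀ x → f x ≢ r) →
                         Restricts f B G → Restricts f (fill B r j) G
fill-restricts-outside {f = f} r j outside res x y with f x ≟ r
... | yes fx≡r = ⊥-elim (outside x fx≡r)
... | no _     = res x y

↑ʳ≢↑ˡ : ∀ {m k} (x : Fin k) (i : Fin m) → m ↑ʳ x ≢ i ↑ˡ k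
↑ʳ≢↑ˡ {m} {k} x i e
  with () ← trans (sym (splitAt-↑ʳ m k x)) (trans (cong (splitAt m) e) (splitAt-↑ˡ m i k))

↑ˡ-adjacent : ∀ {m} k {i i' : Fin m} → Adjacent i i' → Adjacent (i ↑ˡ k) (i' ↑ˡ k)
↑ˡ-adjacent k {i} {i'} adj rewrite toℕ-↑ˡ i k | toℕ-↑ˡ i' k = adj

↑ʳ-adjacent : ∀ m {k} {i i' : Fin k} → Adjacent i i' → Adjacent (m ↑ʳ i) (m ↑ʳ i')
↑ʳ-adjacent m {i = i} {i'} adj rewrite toℕ-↑ʳ m i | toℕ-↑ʳ m i' | adj = +-suc m (toℕ i)

data RowView (m k : ℕ) : Fin (m + k) → Set where
  top    : (i : Fin m) → RowView m k (i ↑ˡ k)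
  bottom : (i : Fin k) → RowView m k (m ↑ʳ i)

rowView : ∀ m k (r : Fin (m + k)) → RowView m k r
rowView zero    k r       = bottom r
rowView (suc m) k zero    = top zero
rowView (suc m) k (suc r) with rowView m k r
... | top i    = top (suc i)
... | bottom i = bottom i

record Stacked {m k n} (B : Board (m + k) n) (G : Board m n) (H : Board k n) : Set where
  field
    upper : Restricts (_↑ˡ k) B G
    lower : Restricts (m ↑ʳ_) B H
open Stacked

emptyBoard-stacked : ∀ {m k n} → Stacked (emptyBoard (m + k) n) (emptyBoard m n) (emptyBoard k n)
emptyBoard-stacked = record { upper = λ _ _ → refl ; lower = λ _ _ → refl }

module _ {m k n : ℕ} where

  fill-upper : ∀ {B G H} (i : Fin m) (j : Fin n) →
               Stacked B G H → Stacked (fill B (i ↑ˡ k) j) (fill G i j) H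
  fill-upper {B} {G} {H} i j s = record
    { upper = fill-restricts {B = B} {G = G} (↑ˡ-injective k _ _) i j (upper s)
    ; lower = fill-restricts-outside {B = B} {G = H} (i ↑ˡ k) j (λ x → ↑ʳ≢↑ˡ x i) (lower s)
    }

  fill-lower : ∀ {B G H} (i : Fin k) (j : Fin n) →
               Stacked B G H → Stacked (fill B (m ↑ʳ i) j) G (fill H i j)
  fill-lower {B} {G} {H} i j s = record
    { upper = fill-restricts-outside {B = B} {G = G} (m ↑ʳ i) j (λ x e → ↑ʳ≢↑ˡ i x (sym e)) (upper s)
    ; lower = fill-restricts {B = B} {G = H} (↑ʳ-injective m _ _) i j (lower s)
    }

  mutual
    stacked-hepLosesFirst : ∀ {B G H} → Stacked B G H →
                            HepLosesFirst G → HepLosesFirst H → HepLosesFirst B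
    stacked-hepLosesFirst s g h = hlose λ r → stacked-hepMove s g h r (rowView m k r)

    stacked-hepMove : ∀ {B G H} → Stacked B G H → HepLosesFirst G → HepLosesFirst H →
                      (r : Fin (m + k)) → RowView m k r → (j j' : Fin n) → Adjacent j j' →
                      B r j ≡ true → B r j' ≡ true → VeraWinsFirst (fill (fill B r j) r j')
    stacked-hepMove s (hlose replies) h _ (top i) j j' adj e e' =
      stacked-veraWinsFirst-upper (fill-upper i j' (fill-upper i j s))
        (replies i j j' adj (trans (sym (upper s i j)) e) (trans (sym (upper s i j')) e')) h
    stacked-hepMove s g (hlose replies) _ (bottom i) j j' adj e e' =
      stacked-veraWinsFirst-lower (fill-lower i j' (fill-lower i j s)) g
        (replies i j j' adj (trans (sym (lower s i j)) e) (trans (sym (lower s i j')) e'))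

    stacked-veraWinsFirst-upper : ∀ {B G H} → Stacked B G H →
                                  VeraWinsFirst G → HepLosesFirst H → VeraWinsFirst B
    stacked-veraWinsFirst-upper s (vmove i i' j adj e e' win) h =
      vmove (i ↑ˡ k) (i' ↑ˡ k) j (↑ˡ-adjacent k adj) (trans (upper s i j) e) (trans (upper s i' j) e')
        (stacked-hepLosesFirst (fill-upper i' j (fill-upper i j s)) win h)

    stacked-veraWinsFirst-lower : ∀ {B G H} → Stacked B G H →
                                  HepLosesFirst G → VeraWinsFirst H → VeraWinsFirst B
    stacked-veraWinsFirst-lower s g (vmove i i' j adj e e' win) =
      vmove (m ↑ʳ i) (m ↑ʳ i') j (↑ʳ-adjacent m adj) (trans (lower s i j) e) (trans (lower s i' j) e')
        (stacked-hepLosesFirst (fill-lower i' j (fill-lower i j s)) g win)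

  stacked-veraWin : ∀ {B G H} → Stacked B G H → HepLosesFirst G → VeraWin H → VeraWin B
  stacked-veraWin s g (veraFirst , hepFirst) =
    stacked-veraWinsFirst-lower s g veraFirst , stacked-hepLosesFirst s g hepFirst

-- The stacking argument also covers m = 0.
mainTheorem12 : (m n : ℕ) → 0 < m → m < n →
    SecondPlayerWin (emptyBoard m n) ⊎ VeraWin (emptyBoard m n) →
    ¬ VeraWin (emptyBoard (n ∸ m) n)
mainTheorem12 m n _ m<n upperOutcome lowerWin =
  symmetric⇒¬veraWin (λ _ _ → refl)
    (subst (λ r → VeraWin (emptyBoard r n)) (m+[n∸m]≡n (<⇒≤ m<n)) squareWin)
  where
  hepLosesFirst : HepLosesFirst (emptyBoard m n)
  hepLosesFirst = [ proj₂ , proj₂ ] upperOutcome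

  squareWin : VeraWin (emptyBoard (m + (n ∸ m)) n)
  squareWin = stacked-veraWin emptyBoard-stacked hepLosesFirst lowerWin
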